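{- Let $(G,k)$ be a reduced instance of \textsc{Trivially Perfect Editing}, let $X$ be a small TP-modulator of $G$, and let $\preceq_N$ be the quasi-order on $V(G)\setminus X$ defined below. For $u,v\in V(G)\setminus X$, if $u\preceq_N v$ then $N^X(u)\supseteq N^X(v)$.
   Context: Graphs are finite, simple, undirected; a graph is trivially perfect if it has no induced $C_4$ or $P_4$. \textsc{Trivially Perfect Editing}: given $(G,k)$, decide if some $S\subseteq\binom{V(G)}{2}$, $|S|\le k$, makes $(V(G),E(G)\triangle S)$ trivially perfect. The instance $(G,k)$ is reduced if neither of the following holds: (i) there is a non-edge $uv$ such that the complement of $G[N(u)\cap N(v)]$ has a matching of size $\ge k+1$; (ii) there is an edge $uv$ and $k+1$ pairwise disjoint non-adjacent pairs $\{a,b\}$ with $a\in N(u)\setminus N[v]$, $b\in N(v)\setminus N[u]$. An obstruction is a 4-vertex set $W$ with $G[W]\cong C_4$ or $P_4$. $X\subseteq V(G)$ is a TP-modulator if every obstruction $W$ has $|W\cap X|\ge2$, and if $|W\cap X|=2$, $W\cap X=\{x_1,x_2\}$, $W\setminus X=\{y_1,y_2\}$, then $G[W]$ is not the $C_4$ $x_1-y_1-y_2-x_2-x_1$ nor the $P_4$ $x_1-y_1-y_2-x_2$; it is small if $|X|\le 4k$. A universal clique decomposition of a trivially perfect graph $H$ is a pair $(T,\{B_t\}_{t\in V(T)})$ with $T$ a rooted forest and the $B_t$ a partition of $V(H)$ into nonempty sets such that if $vw\in E(H)$, $v\in B_t$, $w\in B_s$, then $t=s$ or one of $t,s$ is an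 ancestor of the other, and each $B_t$ is exactly the set of universal vertices of $H[\bigcup_{s\in V(T_t)}B_s]$, $T_t$ the subtree rooted at $t$; it is unique up to isomorphism. Take the one of $G-X$. For $v\notin X$, $N^X(v)=N(v)\cap X$. For $u\in B_t$, $v\in B_s$ with $t\neq s$: $u\preceq_N v$ iff $t$ is an ancestor of $s$; for $u,v$ in the same bag: $u\preceq_N v$ iff $N^X(u)\supseteq N^X(v)$. -}

module Defs where

open import Data.Nat using (ℕ; zero; suc; _+_; _*_; _≤_)
open import Data.Fin using (Fin)
open import Data.Fin.Subset using (Subset; _∈_; _∉_; ∣_∣)
open import Data.Maybe using (Maybe; just)
open import Data.Product using (Σ; ∃; _×_; _,_)
open import Data.Sum using (_⊎_)
open import Data.Bool using (Bool; true; false; if_then_else_)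
open import Data.Vec using (lookup)
open import Relation.Nullary using (¬_; Dec)
open import Relation.Binary.PropositionalEquality using (_≡_; _≢_)
open import Function using (Injective)

record Graph (n : ℕ) : Set₁ where
  field
    _~_   : Fin n → Fin n → Set
    sym   : ∀ {u v} → u ~ v → v ~ u
    irrefl : ∀ {u} → ¬ (u ~ u)
    dec   : ∀ u v → Dec (u ~ v)

module _ {n : ℕ} (G : Graph n) where
  open Graph G

  -- Reduction rule (i): a non-edge uv such that the complement of
  -- G[N(u) ∩ N(v)] has a matching of size k+1 (pairs (as i, bs i),
  -- all 2(k+1) endpoints distinct).
  RuleI : ℕ → Set
  RuleI k =
    Σ (Fin n) λ u → Σ (Fin n) λ v → u ≢ v × ¬ (u ~ v) ×
    Σ (Fin (suc k) → Fin n) λ as → Σ (Fin (suc k) → Fin n) λ bs →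
      Injective _≡_ _≡_ as × Injective _≡_ _≡_ bs × (∀ i j → as i ≢ bs j) ×
      (∀ i → (u ~ as i) × (v ~ as i) × (u ~ bs i) × (v ~ bs i) × ¬ (as i ~ bs i))

  RuleII : ℕ → Set
  RuleII k =
    Σ (Fin n) λ u → Σ (Fin n) λ v → (u ~ v) ×
    Σ (Fin (suc k) → Fin n) λ as → Σ (Fin (suc k) → Fin n) λ bs →
      Injective _≡_ _≡_ as × Injective _≡_ _≡_ bs × (∀ i j → as i ≢ bs j) ×
      (∀ i → (u ~ as i) × ¬ (v ~ as i) × as i ≢ v ×
             (v ~ bs i) × ¬ (u ~ bs i) × bs i ≢ u × ¬ (as i ~ bs i))

  Reduced : ℕ → Set
  Reduced k = ¬ RuleI k × ¬ RuleII k

  Distinct4 : Fin n → Fin n → Fin n → Fin n → Set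
  Distinct4 a b c d = a ≢ b × a ≢ c × a ≢ d × b ≢ c × b ≢ d × c ≢ d

  IsP4 : Fin n → Fin n → Fin n → Fin n → Set
  IsP4 a b c d = Distinct4 a b c d ×
    (a ~ b) × (b ~ c) × (c ~ d) × ¬ (a ~ c) × ¬ (b ~ d) × ¬ (a ~ d)

  IsC4 : Fin n → Fin n → Fin n → Fin n → Set
  IsC4 a b c d = Distinct4 a b c d ×
    (a ~ b) × (b ~ c) × (c ~ d) × (d ~ a) × ¬ (a ~ c) × ¬ (b ~ d)

  Obstruction : Fin n → Fin n → Fin n → Fin n → Set
  Obstruction a b c d = IsP4 a b c d ⊎ IsC4 a b c d

  inX : Subset n → Fin n → ℕ
  inX X v = if lookup X v then 1 else 0

  TPModulator : Subset n → Set
  TPModulator X =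
    (∀ a b c d → Obstruction a b c d → 2 ≤ inX X a + inX X b + inX X c + inX X d) ×
    (∀ x₁ y₁ y₂ x₂ → x₁ ∈ X → x₂ ∈ X → y₁ ∉ X → y₂ ∉ X →
       ¬ IsC4 x₁ y₁ y₂ x₂ × ¬ IsP4 x₁ y₁ y₂ x₂)

  Small : ℕ → Subset n → Set
  Small k X = ∣ X ∣ ≤ 4 * k

  NXSup : Subset n → Fin n → Fin n → Set
  NXSup X u v = ∀ w → w ∈ X → v ~ w → u ~ w

module _ {m : ℕ} (parent : Fin m → Maybe (Fin m)) where
  data Anc : Fin m → Fin m → Set where
    here  : ∀ {t s} → parent s ≡ just t → Anc t s
    there : ∀ {t p s} → parent s ≡ just p → Anc t p → Anc t s

  InSubtree : Fin m → Fin m → Set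
  InSubtree t s = t ≡ s ⊎ Anc t s

record UCD {n : ℕ} (G : Graph n) (X : Subset n) (m : ℕ) : Set where
  open Graph G
  field
    parent  : Fin m → Maybe (Fin m)
    acyclic : ∀ t → ¬ Anc parent t t
    -- bag of a vertex (only meaningful for vertices outside X)
    bag     : Fin n → Fin m
    nonempty : ∀ t → Σ (Fin n) λ v → v ∉ X × bag v ≡ t
    edges   : ∀ v w → v ∉ X → w ∉ X → v ~ w →
              bag v ≡ bag w ⊎ Anc parent (bag v) (bag w) ⊎ Anc parent (bag w) (bag v)
    -- B_t is exactly the set of universal vertices of (G - X)[⋃_{s ∈ T_t} B_s]
    universal : ∀ t v → v ∉ X →
      (bag v ≡ t → InSubtree parent t (bag v) ×
                   (∀ w → w ∉ X → InSubtree parent t (bag w) → w ≢ v → v ~ w)) ×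
      (InSubtree parent t (bag v) →
                   (∀ w → w ∉ X → InSubtree parent t (bag w) → w ≢ v → v ~ w) → bag v ≡ t)

_⪯N⟨_⟩_ : ∀ {n m} {G : Graph n} {X : Subset n} → Fin n → UCD G X m → Fin n → Set
_⪯N⟨_⟩_ {G = G} {X = X} u D v =
  (bag u ≢ bag v × Anc parent (bag u) (bag v)) ⊎ (bag u ≡ bag v × NXSup G X u v)
  where open UCD D

-- If bag u is a proper ancestor of bag v and some w ∈ X is a neighbour of v
-- but not of u, then every z in the subtree of bag u that is not adjacent to
-- v yields an obstruction w-v-u-z (u is universal there) with only w in X,
-- which a TP-modulator forbids. So v is universal in that subtree and must
-- lie in bag u itself, a contradiction.
module Submission where

open import Defs
open import Data.Nat using (ℕ; s≤s; _≤_; _+_)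
open import Data.Fin using (Fin)
open import Data.Fin.Subset using (Subset; _∈_; _∉_)
open import Data.Bool using (true; false)
open import Data.Vec using (lookup)
open import Data.Vec.Properties using ([]=⇒lookup; lookup⇒[]=)
open import Data.Product using (_,_; proj₁; proj₂)
open import Data.Sum using (inj₁; inj₂)
open import Data.Empty using (⊥-elim)
open import Function using (_∘_)
open import Relation.Nullary using (¬_; yes; no)
open import Relation.Binary.PropositionalEquality
  using (_≡_; _≢_; refl; sym; cong; subst)

∈∉⇒≢ : ∀ {n} {X : Subset n} {a b} → a ∈ X → b ∉ X → a ≢ b
∈∉⇒≢ a∈X b∉X refl = b∉X a∈X

module _ {n : ℕ} (G : Graph n) where
  open Graph G using (_~_; dec) renaming (sym to ~-sym)

  path₃⇒obstruction : ∀ {a b c d} → Distinct4 G a b c d →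
    a ~ b → b ~ c → c ~ d → ¬ a ~ c → ¬ b ~ d → Obstruction G a b c d
  path₃⇒obstruction {a} {d = d} abcd ab bc cd ¬ac ¬bd with dec d a
  ... | yes da = inj₂ (abcd , ab , bc , cd , da , ¬ac , ¬bd)
  ... | no ¬da = inj₁ (abcd , ab , bc , cd , ¬ac , ¬bd , ¬da ∘ ~-sym)

  module _ {X : Subset n} where

    inX-∈ : ∀ {w} → w ∈ X → inX G X w ≡ 1
    inX-∈ w∈X rewrite []=⇒lookup w∈X = refl

    inX-∉ : ∀ {w} → w ∉ X → inX G X w ≡ 0
    inX-∉ {w} w∉X with lookup X w in eq
    ... | true  = ⊥-elim (w∉X (lookup⇒[]= w X eq))
    ... | false = refl

    TPModulator⇒¬obstruction-meeting-X-once : TPModulator G X →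
      ∀ {a b c d} → a ∈ X → b ∉ X → c ∉ X → d ∉ X → ¬ Obstruction G a b c d
    TPModulator⇒¬obstruction-meeting-X-once (meets-twice , _) {a} {b} {c} {d}
      a∈X b∉X c∉X d∉X obs = 2≰1 (subst (2 ≤_) meets-once (meets-twice a b c d obs))
      where
      meets-once : inX G X a + inX G X b + inX G X c + inX G X d ≡ 1
      meets-once rewrite inX-∈ a∈X | inX-∉ b∉X | inX-∉ c∉X | inX-∉ d∉X = refl

      2≰1 : ¬ 2 ≤ 1
      2≰1 (s≤s ())

    ancestor-bag⇒NXSup : TPModulator G X → ∀ {m} (D : UCD G X m) {u v} →
      u ∉ X → v ∉ X → UCD.bag D u ≢ UCD.bag D v →
      Anc (UCD.parent D) (UCD.bag D u) (UCD.bag D v) → NXSup G X u v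
    ancestor-bag⇒NXSup tp D {u} {v} u∉X v∉X bu≢bv anc w w∈X vw with dec u w
    ... | yes uw = uw
    ... | no ¬uw = ⊥-elim (bu≢bv (sym (proj₂ (universal (bag u) v v∉X) (inj₂ anc) v-universal)))
      where
      open UCD D

      u-universal : ∀ z → z ∉ X → InSubtree parent (bag u) (bag z) → z ≢ u → u ~ z
      u-universal = proj₂ (proj₁ (universal (bag u) u u∉X) refl)

      uv : u ~ v
      uv = u-universal v v∉X (inj₂ anc) (bu≢bv ∘ cong bag ∘ sym)

      v-universal : ∀ z → z ∉ X → InSubtree parent (bag u) (bag z) → z ≢ v → v ~ z
      v-universal z z∉X z∈Tu z≢v with dec v z
      ... | yes vz = vz
      ... | no ¬vz =
        ⊥-elim (TPModulator⇒¬obstruction-meeting-X-once tp w∈X v∉X u∉X z∉X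
                  (path₃⇒obstruction wvuz (~-sym vw) (~-sym uv) uz (¬uw ∘ ~-sym) ¬vz))
        where
        u≢z : u ≢ z
        u≢z refl = ¬vz (~-sym uv)

        uz : u ~ z
        uz = u-universal z z∉X z∈Tu (u≢z ∘ sym)

        wvuz : Distinct4 G w v u z
        wvuz = ∈∉⇒≢ w∈X v∉X , ∈∉⇒≢ w∈X u∉X , ∈∉⇒≢ w∈X z∉X ,
               bu≢bv ∘ cong bag ∘ sym , z≢v ∘ sym , u≢z

corollary1 : ∀ {n} (G : Graph n) (k : ℕ) (X : Subset n) →
    Reduced G k → TPModulator G X → Small G k X →
    ∀ {m} (D : UCD G X m) (u v : Fin n) → u ∉ X → v ∉ X →
    u ⪯N⟨ D ⟩ v → NXSup G X u v
corollary1 G k X _ tp _ D u v u∉X v∉X (inj₁ (bu≢bv , anc)) =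
  ancestor-bag⇒NXSup G tp D u∉X v∉X bu≢bv anc
corollary1 G k X _ _ _ D u v _ _ (inj₂ (_ , u⊇v)) = u⊇v
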